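{- Let \(\mathcal V\) be a universe and view \(\Omega_{\mathcal V}\) as a \(\delta_{\mathcal V}\)-complete poset ordered by implication, where for propositions \(Q\to R\) and \(P\) in \(\mathcal V\), \(\bigvee\delta_{Q,R,P}=Q\vee(R\times P)\). Suppose that for all propositions \(Q,R:\mathcal V\) with \(Q\sqsubseteq R\) and \(Q\neq R\), and for every proposition \(P:\mathcal V\), the equality \(R=\bigvee\delta_{Q,R,P}\) in \(\Omega_{\mathcal V}\) implies \(P\). Then excluded middle in \(\mathcal V\) holds.
   Context: Setting: intensional Martin-Löf type theory with universes, function extensionality, propositional extensionality, propositional truncation; \(Q\vee R:=\|Q+R\|\). A proposition is a type with at most one element; \(\Omega_{\mathcal V}\) is the type of propositions in \(\mathcal V\). For \(x\sqsubseteq y\) in a poset and a proposition \(P\), \(\delta_{x,y,P}:\mathbf 1+P\to X\) sends \(\mathrm{inl}(\star)\mapsto x\), \(\mathrm{inr}(p)\mapsto y\), and \(\bigvee\delta_{x,y,P}\) is its supremum. Excluded middle in \(\mathcal V\): every proposition \(P:\mathcal V\) satisfies \(P\) or \(\neg P\). -}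

module Defs where

open import Level using (Level; suc; _⊔_)
open import Data.Product using (Σ; _×_; _,_; proj₁; proj₂)
open import Data.Sum using (_⊎_; inj₁; inj₂)
open import Relation.Nullary using (¬_)
open import Relation.Binary.PropositionalEquality using (_≡_)

isProp : ∀ {ℓ} → Set ℓ → Set ℓ
isProp A = (x y : A) → x ≡ y

Ω : (ℓ : Level) → Set (suc ℓ)
Ω ℓ = Σ (Set ℓ) isProp

PropExt : (ℓ : Level) → Set (suc ℓ)
PropExt ℓ = (P Q : Set ℓ) → isProp P → isProp Q → (P → Q) → (Q → P) → P ≡ Q

record Truncation (ℓ : Level) : Set (suc ℓ) where
  field
    ∥_∥      : Set ℓ → Set ℓ
    ∥∥-isProp : (A : Set ℓ) → isProp ∥ A ∥
    ∣_∣      : {A : Set ℓ} → A → ∥ A ∥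
    ∥∥-rec   : {A B : Set ℓ} → isProp B → (A → B) → ∥ A ∥ → B

module _ {ℓ : Level} (T : Truncation ℓ) where
  open Truncation T

  _∨_ : Set ℓ → Set ℓ → Set ℓ
  Q ∨ R = ∥ Q ⊎ R ∥

  _⊑_ : Ω ℓ → Ω ℓ → Set ℓ
  Q ⊑ R = proj₁ Q → proj₁ R

  ⋁δ : Ω ℓ → Ω ℓ → Ω ℓ → Ω ℓ
  ⋁δ Q R P = (proj₁ Q ∨ (proj₁ R × proj₁ P)) , ∥∥-isProp _

  Hyp : Set (suc ℓ)
  Hyp = (Q R : Ω ℓ) → Q ⊑ R → ¬ (Q ≡ R) → (P : Ω ℓ) → R ≡ ⋁δ Q R P → proj₁ P

EM : (ℓ : Level) → Set (suc ℓ)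
EM ℓ = (P : Set ℓ) → isProp P → P ⊎ ¬ P

-- Instantiate the hypothesis with Q = ⊥ and P = R: since ⋁δ ⊥ R R = R always
-- holds, and R ≠ ⊥ whenever ¬¬R, the hypothesis yields double-negation
-- elimination for all propositions. Applied to the proposition P + ¬P, which is
-- never refutable, this is excluded middle.
module Submission where

open import Defs
open import Level using (Level; Setω)
open import Axiom.Extensionality.Propositional using (Extensionality)
open import Axiom.UniquenessOfIdentityProofs using (module Constant⇒UIP)
open import Data.Empty.Polymorphic using (⊥)
open import Data.Product using (_,_; proj₁; proj₂)
open import Data.Sum using (_⊎_; inj₁; inj₂)
open import Function using (_∘_)
open import Relation.Nullary using (¬_; contradiction)
open import Relation.Binary.PropositionalEquality

FunExt : Setω
FunExt = ∀ {a b} → Extensionality a b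

module _ {ℓ : Level} where

  isProp⇒≡-isProp : {A : Set ℓ} → isProp A → (x y : A) → isProp (x ≡ y)
  isProp⇒≡-isProp A-prop x y = Constant⇒UIP.≡-irrelevant (λ {x} {y} _ → A-prop x y) (λ _ _ → refl)

  isProp-isProp : FunExt → {A : Set ℓ} → isProp (isProp A)
  isProp-isProp fe A-prop A-prop′ =
    fe λ x → fe λ y → isProp⇒≡-isProp A-prop x y (A-prop x y) (A-prop′ x y)

  isProp-¬ : FunExt → {A : Set ℓ} → isProp (¬ A)
  isProp-¬ fe f g = fe λ x → contradiction x f

  isProp-⊎-¬ : FunExt → {A : Set ℓ} → isProp A → isProp (A ⊎ ¬ A)
  isProp-⊎-¬ fe A-prop (inj₁ x) (inj₁ y) = cong inj₁ (A-prop x y)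
  isProp-⊎-¬ fe A-prop (inj₁ x) (inj₂ f) = contradiction x f
  isProp-⊎-¬ fe A-prop (inj₂ f) (inj₁ y) = contradiction y f
  isProp-⊎-¬ fe A-prop (inj₂ f) (inj₂ g) = cong inj₂ (isProp-¬ fe f g)

  Ω-ext : FunExt → PropExt ℓ → (X Y : Ω ℓ) → (proj₁ X → proj₁ Y) → (proj₁ Y → proj₁ X) → X ≡ Y
  Ω-ext fe pe (A , A-prop) (B , B-prop) to from
    with refl ← pe A B A-prop B-prop to from = cong (A ,_) (isProp-isProp fe A-prop B-prop)

  ⊥Ω : Ω ℓ
  ⊥Ω = ⊥ , λ ()

  ⊥Ω-⊑ : (T : Truncation ℓ) (R : Ω ℓ) → _⊑_ T ⊥Ω R
  ⊥Ω-⊑ T R ()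

  ¬¬⇒≢⊥Ω : (R : Ω ℓ) → ¬ ¬ proj₁ R → ¬ (⊥Ω ≡ R)
  ¬¬⇒≢⊥Ω R ¬¬r refl = ¬¬r λ ()

  ⋁δ-⊥Ω-diagonal : FunExt → PropExt ℓ → (T : Truncation ℓ) (R : Ω ℓ) → R ≡ ⋁δ T ⊥Ω R R
  ⋁δ-⊥Ω-diagonal fe pe T R = Ω-ext fe pe R (⋁δ T ⊥Ω R R)
    (λ r → ∣ inj₂ (r , r) ∣)
    (∥∥-rec (proj₂ R) λ { (inj₁ ()) ; (inj₂ (r , _)) → r })
    where open Truncation T

  Hyp⇒¬¬-elim : FunExt → PropExt ℓ → (T : Truncation ℓ) → Hyp T
              → (R : Ω ℓ) → ¬ ¬ proj₁ R → proj₁ R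
  Hyp⇒¬¬-elim fe pe T hyp R ¬¬r =
    hyp ⊥Ω R (⊥Ω-⊑ T R) (¬¬⇒≢⊥Ω R ¬¬r) R (⋁δ-⊥Ω-diagonal fe pe T R)

¬¬-excluded-middle : ∀ {ℓ} {A : Set ℓ} → ¬ ¬ (A ⊎ ¬ A)
¬¬-excluded-middle k = k (inj₂ (k ∘ inj₁))

proposition3p7 : {ℓ : Level} → (∀ {a b} → Extensionality a b) → PropExt ℓ
                 → (T : Truncation ℓ) → Hyp T → EM ℓ
proposition3p7 fe pe T hyp P P-prop =
  Hyp⇒¬¬-elim fe pe T hyp ((P ⊎ ¬ P) , isProp-⊎-¬ fe P-prop) ¬¬-excluded-middle
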